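{- Let $T_6$ be the $3$-graph on $[6]$ defined as follows: fix a partition of $[6]$ into three parts $A_1,A_2,A_3$ of size $2$; the edges are the $8$ triples with exactly one vertex in each part, together with, for each $i\in\{1,2,3\}$, the two triples $A_i\cup\{w\}$ with $w\in A_{i+1}$ (indices modulo $3$, so $A_4=A_1$). Then $\lambda(T_6)\le\lambda(K_5^3)-10^{ -3}$, where $\lambda(K_5^3)=2/25$.
   Context: For a $3$-graph $G$ on $[n]$, $\lambda(G)=\max\{\sum_{e\in E(G)}\prod_{i\in e}x_i: x_i\ge0,\ \sum_i x_i=1\}$; $K_5^3$ is the complete $3$-graph on $5$ vertices.
   Formalization: The maximum defining λ is taken over the points of the simplex with rational coordinates rather than real ones, for both $T_6$ and $K_5^3$. -}

module Defs where

open import Data.Nat using (ℕ; zero; suc)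
open import Data.Fin using (Fin; zero; suc)
open import Data.List using (List; []; _∷_; _++_; map; allFin)
open import Data.Product using (_×_; _,_; Σ)
open import Data.Rational using (ℚ; 0ℚ; 1ℚ; _+_; _*_; _-_; _≤_; _/_)
open import Data.Integer using (+_)
open import Relation.Binary.PropositionalEquality using (_≡_)

-- A 3-graph on vertex set Fin n, given by its list of edges (3-element sets,
-- each written as a triple of distinct vertices).
Edge : ℕ → Set
Edge n = Fin n × Fin n × Fin n

ThreeGraph : ℕ → Set
ThreeGraph n = List (Edge n)

sumFin : ∀ {n} → (Fin n → ℚ) → ℚ
sumFin {zero}  x = 0ℚ
sumFin {suc n} x = x zero + sumFin {n} (λ i → x (suc i))

weight : ∀ {n} → ThreeGraph n → (Fin n → ℚ) → ℚ
weight []                x = 0ℚ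
weight ((a , b , c) ∷ es) x = x a * x b * x c + weight es x

InSimplex : ∀ {n} → (Fin n → ℚ) → Set
InSimplex {n} x = ((i : Fin n) → 0ℚ ≤ x i) × (sumFin x ≡ 1ℚ)

LagrangianBoundedBy : ∀ {n} → ThreeGraph n → ℚ → Set
LagrangianBoundedBy {n} G c = (x : Fin n → ℚ) → InSimplex x → weight G x ≤ c

LagrangianIs : ∀ {n} → ThreeGraph n → ℚ → Set
LagrangianIs {n} G c =
  LagrangianBoundedBy G c × Σ (Fin n → ℚ) (λ x → InSimplex x × weight G x ≡ c)

pairsOf : ∀ {n} → List (Fin n) → List (Fin n × Fin n)
pairsOf []       = []
pairsOf (a ∷ xs) = map (λ b → a , b) xs ++ pairsOf xs

triplesOf : ∀ {n} → List (Fin n) → List (Edge n)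
triplesOf []       = []
triplesOf (a ∷ xs) = map (λ p → a , p) (pairsOf xs) ++ triplesOf xs

K3 : (n : ℕ) → ThreeGraph n
K3 n = triplesOf (allFin n)

K5 : ThreeGraph 5
K5 = K3 5

-- vertices of [6] as Fin 6: v0..v5.  Parts A1 = {v0,v1}, A2 = {v2,v3}, A3 = {v4,v5}.
v0 v1 v2 v3 v4 v5 : Fin 6
v0 = zero
v1 = suc zero
v2 = suc (suc zero)
v3 = suc (suc (suc zero))
v4 = suc (suc (suc (suc zero)))
v5 = suc (suc (suc (suc (suc zero))))

T6 : ThreeGraph 6
T6 =
    (v0 , v2 , v4) ∷ (v0 , v2 , v5) ∷ (v0 , v3 , v4) ∷ (v0 , v3 , v5)
  ∷ (v1 , v2 , v4) ∷ (v1 , v2 , v5) ∷ (v1 , v3 , v4) ∷ (v1 , v3 , v5)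
  ∷ (v0 , v1 , v2) ∷ (v0 , v1 , v3)
  ∷ (v2 , v3 , v4) ∷ (v2 , v3 , v5)
  ∷ (v4 , v5 , v0) ∷ (v4 , v5 , v1)
  ∷ []

lamK5 : ℚ
lamK5 = + 2 / 25

gap : ℚ
gap = + 1 / 1000

-- Each bound comes from a polynomial identity  w(G,x) + r(x) = c (x₀ + ⋯ + x_{n-1})³  whose
-- remainder r is nonnegative on the orthant by its very shape (built from coordinates,
-- nonnegative constants and squares), so that w(G,x) ≤ c on the simplex; the identity itself
-- is checked by comparing normal forms.  The uniform vector attains 2/25 for K₅.  For T₆, writing
-- x₀x₁ = ((x₀+x₁)² − (x₀−x₁)²)/4, and likewise inside the other two parts, reduces w(T₆,x) to the
-- cubic  abc + (a²b + b²c + c²a)/4  in the part sums a, b, c, which is at most 79/1000 (a+b+c)³.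
module Submission where

open import Defs
open import Data.Bool using (T)
open import Data.Fin using (Fin; zero; suc; #_)
open import Data.Integer using (+_)
open import Data.List using ([]; _∷_)
open import Data.Nat using (ℕ; zero; suc)
open import Data.Product using (_×_; _,_)
open import Data.Rational
  using (ℚ; 0ℚ; 1ℚ; _+_; _*_; _-_; _≤_; _/_; _≤ᵇ_; nonNegative; nonPositive)
open import Data.Rational.Properties
  using (+-mono-≤; +-monoʳ-≤; +-identityʳ; *-identityʳ; ≤-total; ≤ᵇ⇒≤; nonNegative⁻¹;
         nonNeg*nonNeg⇒nonNeg; nonPos*nonPos⇒nonPos; module ≤-Reasoning)
open import Data.Rational.Solver using (module +-*-Solver)
open import Data.Sum using (inj₁; inj₂)
open import Data.Vec using (Vec; lookup; tabulate)
open import Data.Vec.Properties using (lookup∘tabulate)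
open import Function using (_∘_)
open import Relation.Binary.PropositionalEquality
  using (_≡_; refl; sym; trans; cong; cong₂; subst)

open +-*-Solver
  using (Polynomial; con; var; _:+_; _:*_; _:-_; ⟦_⟧; ⟦_⟧N; normalise; correct)

private
  variable
    n : ℕ
    p q : ℚ

+-nonneg : 0ℚ ≤ p → 0ℚ ≤ q → 0ℚ ≤ p + q
+-nonneg = +-mono-≤

*-nonneg : 0ℚ ≤ p → 0ℚ ≤ q → 0ℚ ≤ p * q
*-nonneg {p} {q} p≥0 q≥0 =
  nonNegative⁻¹ _ {{nonNeg*nonNeg⇒nonNeg p {{nonNegative p≥0}} q {{nonNegative q≥0}}}}

square-nonneg : ∀ p → 0ℚ ≤ p * p
square-nonneg p with ≤-total 0ℚ p
... | inj₁ p≥0 = *-nonneg p≥0 p≥0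
... | inj₂ p≤0 =
  nonNegative⁻¹ _ {{nonPos*nonPos⇒nonPos p {{nonPositive p≤0}} p {{nonPositive p≤0}}}}

p≤p+q : ∀ p → 0ℚ ≤ q → p ≤ p + q
p≤p+q p q≥0 = subst (_≤ p + _) (+-identityʳ p) (+-monoʳ-≤ p q≥0)

infixl 6 _⊕_
infixl 7 _⊗_

data NonnegExpr (n : ℕ) : Set where
  coord  : Fin n → NonnegExpr n
  const  : (q : ℚ) → {T (0ℚ ≤ᵇ q)} → NonnegExpr n
  square : Polynomial n → NonnegExpr n
  _⊕_ _⊗_ : NonnegExpr n → NonnegExpr n → NonnegExpr n

toPolynomial : NonnegExpr n → Polynomial n
toPolynomial (coord i)   = var i
toPolynomial (const q)   = con q
toPolynomial (square p)  = p :* p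
toPolynomial (e ⊕ f)     = toPolynomial e :+ toPolynomial f
toPolynomial (e ⊗ f)     = toPolynomial e :* toPolynomial f

toPolynomial-nonneg : (x : Fin n → ℚ) → (∀ i → 0ℚ ≤ x i) →
                      ∀ e → 0ℚ ≤ ⟦ toPolynomial e ⟧ (tabulate x)
toPolynomial-nonneg x x≥0 (coord i)        = subst (0ℚ ≤_) (sym (lookup∘tabulate x i)) (x≥0 i)
toPolynomial-nonneg x x≥0 (const q {q≥0})  = ≤ᵇ⇒≤ q≥0
toPolynomial-nonneg x x≥0 (square p)       = square-nonneg (⟦ p ⟧ (tabulate x))
toPolynomial-nonneg x x≥0 (e ⊕ f) =
  +-nonneg (toPolynomial-nonneg x x≥0 e) (toPolynomial-nonneg x x≥0 f)
toPolynomial-nonneg x x≥0 (e ⊗ f) =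
  *-nonneg (toPolynomial-nonneg x x≥0 e) (toPolynomial-nonneg x x≥0 f)

lagrangianPolynomial : ThreeGraph n → Polynomial n
lagrangianPolynomial []                = con 0ℚ
lagrangianPolynomial ((a , b , c) ∷ es) = var a :* var b :* var c :+ lagrangianPolynomial es

sumPolynomial : ∀ {k} → (Fin k → Polynomial n) → Polynomial n
sumPolynomial {k = zero}  ps = con 0ℚ
sumPolynomial {k = suc k} ps = ps zero :+ sumPolynomial (ps ∘ suc)

coordinateSum : Polynomial n
coordinateSum = sumPolynomial var

cubeOfCoordinateSum : Polynomial n
cubeOfCoordinateSum = coordinateSum :* coordinateSum :* coordinateSum

sumFin-cong : ∀ {k} {x y : Fin k → ℚ} → (∀ i → x i ≡ y i) → sumFin x ≡ sumFin y
sumFin-cong {k = zero}  x≡y = refl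
sumFin-cong {k = suc k} x≡y = cong₂ _+_ (x≡y zero) (sumFin-cong (x≡y ∘ suc))

⟦sumPolynomial⟧ : ∀ {k} (ps : Fin k → Polynomial n) ρ →
                  ⟦ sumPolynomial ps ⟧ ρ ≡ sumFin (λ i → ⟦ ps i ⟧ ρ)
⟦sumPolynomial⟧ {k = zero}  ps ρ = refl
⟦sumPolynomial⟧ {k = suc k} ps ρ = cong (λ t → ⟦ ps zero ⟧ ρ + t) (⟦sumPolynomial⟧ (ps ∘ suc) ρ)

⟦coordinateSum⟧ : (x : Fin n → ℚ) → ⟦ coordinateSum ⟧ (tabulate x) ≡ sumFin x
⟦coordinateSum⟧ x = trans (⟦sumPolynomial⟧ var (tabulate x)) (sumFin-cong (lookup∘tabulate x))

⟦lagrangianPolynomial⟧ : (G : ThreeGraph n) (x : Fin n → ℚ) →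
                         ⟦ lagrangianPolynomial G ⟧ (tabulate x) ≡ weight G x
⟦lagrangianPolynomial⟧ []                 x = refl
⟦lagrangianPolynomial⟧ ((a , b , c) ∷ es) x =
  cong₂ _+_ (cong₂ _*_ (cong₂ _*_ (xᵢ a) (xᵢ b)) (xᵢ c)) (⟦lagrangianPolynomial⟧ es x)
  where
  xᵢ : ∀ i → lookup (tabulate x) i ≡ x i
  xᵢ = lookup∘tabulate x

normalise-≡⇒⟦⟧-≡ : (p q : Polynomial n) → normalise p ≡ normalise q → ∀ ρ → ⟦ p ⟧ ρ ≡ ⟦ q ⟧ ρ
normalise-≡⇒⟦⟧-≡ p q p↓≡q↓ ρ =
  trans (sym (correct p ρ)) (trans (cong (λ r → ⟦ r ⟧N ρ) p↓≡q↓) (correct q ρ))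

lagrangianBoundedBy-certificate :
  (G : ThreeGraph n) (c : ℚ) (r : NonnegExpr n) →
  normalise (lagrangianPolynomial G :+ toPolynomial r) ≡ normalise (con c :* cubeOfCoordinateSum) →
  LagrangianBoundedBy G c
lagrangianBoundedBy-certificate {n} G c r identity x (x≥0 , Σx≡1) = begin
  weight G x                        ≤⟨ p≤p+q _ (toPolynomial-nonneg x x≥0 r) ⟩
  weight G x + ⟦ toPolynomial r ⟧ ρ ≡⟨ cong (_+ ⟦ toPolynomial r ⟧ ρ) (⟦lagrangianPolynomial⟧ G x) ⟨
  ⟦ lhs ⟧ ρ                         ≡⟨ normalise-≡⇒⟦⟧-≡ lhs rhs identity ρ ⟩
  c * (s * s * s)                   ≡⟨ cong (λ t → c * (t * t * t)) (trans (⟦coordinateSum⟧ x) Σx≡1) ⟩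
  c * 1ℚ                            ≡⟨ *-identityʳ c ⟩
  c                                 ∎
  where
  open ≤-Reasoning
  ρ : Vec ℚ n
  ρ = tabulate x
  s : ℚ
  s = ⟦ coordinateSum ⟧ ρ
  lhs rhs : Polynomial n
  lhs = lagrangianPolynomial G :+ toPolynomial r
  rhs = con c :* cubeOfCoordinateSum

k5Certificate : NonnegExpr 5
k5Certificate =
    pair (# 0) (# 1) (# 2) (# 3) (# 4) ⊕ pair (# 0) (# 2) (# 1) (# 3) (# 4)
  ⊕ pair (# 0) (# 3) (# 1) (# 2) (# 4) ⊕ pair (# 0) (# 4) (# 1) (# 2) (# 3)
  ⊕ pair (# 1) (# 2) (# 0) (# 3) (# 4) ⊕ pair (# 1) (# 3) (# 0) (# 2) (# 4)
  ⊕ pair (# 1) (# 4) (# 0) (# 2) (# 3) ⊕ pair (# 2) (# 3) (# 0) (# 1) (# 4)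
  ⊕ pair (# 2) (# 4) (# 0) (# 1) (# 3) ⊕ pair (# 3) (# 4) (# 0) (# 1) (# 2)
  where
  pair : (i j k l m : Fin 5) → NonnegExpr 5
  pair i j k l m =
    (const (+ 13 / 150) ⊗ (coord k ⊕ coord l ⊕ coord m) ⊕ const (+ 1 / 50) ⊗ (coord i ⊕ coord j))
      ⊗ square (var i :- var j)

-- Equals 79/1000 (a+b+c)³ − abc − (a²b + b²c + c²a)/4.
cubicCertificate : (a b c : NonnegExpr n) → NonnegExpr n
cubicCertificate a b c =
  cyclicTerm a b c ⊕ cyclicTerm b c a ⊕ cyclicTerm c a b ⊕ const (+ 7 / 500) ⊗ a ⊗ b ⊗ c
  where
  cyclicTerm : (a b c : NonnegExpr n) → NonnegExpr n
  cyclicTerm a b c =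
      const (+ 9 / 100) ⊗ a ⊗ square (toPolynomial b :- toPolynomial c)
    ⊕ const (+ 3 / 50) ⊗ a ⊗ square (toPolynomial a :- toPolynomial b)
    ⊕ const (+ 19 / 1000) ⊗ a ⊗ a ⊗ a
    ⊕ const (+ 17 / 1000) ⊗ a ⊗ a ⊗ b
    ⊕ const (+ 87 / 1000) ⊗ a ⊗ b ⊗ b

t6Certificate : NonnegExpr 6
t6Certificate =
    const (+ 1 / 4) ⊗ ( a₂ ⊗ square (var v0 :- var v1)
                      ⊕ a₃ ⊗ square (var v2 :- var v3)
                      ⊕ a₁ ⊗ square (var v4 :- var v5))
  ⊕ cubicCertificate a₁ a₂ a₃
  where
  a₁ a₂ a₃ : NonnegExpr 6
  a₁ = coord v0 ⊕ coord v1
  a₂ = coord v2 ⊕ coord v3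
  a₃ = coord v4 ⊕ coord v5

lagrangian-K5 : LagrangianIs K5 lamK5
lagrangian-K5 =
    lagrangianBoundedBy-certificate K5 lamK5 k5Certificate refl
  , (λ _ → + 1 / 5) , ((λ _ → ≤ᵇ⇒≤ _) , refl) , refl

lagrangian-T6-bound : LagrangianBoundedBy T6 (lamK5 - gap)
lagrangian-T6-bound = lagrangianBoundedBy-certificate T6 (lamK5 - gap) t6Certificate refl

lemma3p9 : LagrangianIs K5 lamK5 × LagrangianBoundedBy T6 (lamK5 - gap)
lemma3p9 = lagrangian-K5 , lagrangian-T6-bound
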